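{- If $f$ is a nice formula with $v(f)$ variables, then $AE(f)\ge 1+2^{1-v(f)}$.
   Context: Variables are letters of an alphabet $\Delta=\{A,B,C,\dots\}$. A formula is a finite set of non-empty words over $\Delta$, called fragments, written separated by dots; $v(f)$ denotes the number of distinct variables occurring in $f$. A formula $f$ is nice if for every variable $X$ of $f$ there is a fragment of $f$ containing $X$ at least twice. An occurrence of $f$ in a word $w$ over an alphabet $\Sigma$ is a non-erasing morphism $h:\Delta^*\to\Sigma^*$ such that $h(\phi)$ is a factor of $w$ for every fragment $\phi$ of $f$; $w$ avoids $f$ if it contains no occurrence of $f$. The exponent of a non-empty word $u$ is $|u|/p$ with $p$ the smallest period of $u$; a word is $\alpha$-free if it has no factor of exponent at least $\alpha$. The avoidability exponent $AE(f)$ is the largest real $\alpha$ such that every $\alpha$-free word (over any finite alphabet) avoids $f$. -}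

module Defs where

open import Data.Nat using (ℕ; zero; suc; _+_; _*_; _^_; _≤_; _<_)
open import Data.Nat.Properties using (_≟_)
open import Data.Fin using (Fin)
open import Data.List using (List; []; _∷_; _++_; length; concat; concatMap; deduplicate; filter)
open import Data.List.Membership.Propositional using (_∈_)
open import Data.Maybe using (Maybe; just; nothing)
open import Data.Product using (Σ; ∃; ∃-syntax; _×_; _,_)
open import Relation.Binary.PropositionalEquality using (_≡_; _≢_)
open import Relation.Nullary using (¬_)

Var : Set
Var = ℕ

-- A formula: finite list of fragments (non-empty words over Δ).
Formula : Set
Formula = List (List Var)

Fragments-nonempty : Formula → Set
Fragments-nonempty f = ∀ φ → φ ∈ f → φ ≢ []

v : Formula → ℕ
v f = length (deduplicate _≟_ (concat f))

occ : Var → List Var → ℕ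
occ X [] = 0
occ X (Y ∷ φ) with X ≟ Y
... | Relation.Nullary.yes _ = suc (occ X φ)
... | Relation.Nullary.no _ = occ X φ

Nice : Formula → Set
Nice f = ∀ X → X ∈ concat f → ∃[ φ ] (φ ∈ f × 2 ≤ occ X φ)

Factor : {S : Set} → List S → List S → Set
Factor {S} x w = ∃[ u ] ∃[ u' ] (w ≡ u ++ x ++ u')

Morphism : ℕ → Set
Morphism k = Var → List (Fin k)

NonErasing : {k : ℕ} → Morphism k → Set
NonErasing h = ∀ X → h X ≢ []

apply : {k : ℕ} → Morphism k → List Var → List (Fin k)
apply h φ = concatMap h φ

Occurrence : {k : ℕ} → Formula → List (Fin k) → Morphism k → Set
Occurrence f w h = NonErasing h × (∀ φ → φ ∈ f → Factor (apply h φ) w)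

Avoids : {k : ℕ} → Formula → List (Fin k) → Set
Avoids {k} f w = ∀ (h : Morphism k) → ¬ Occurrence f w h

-- i-th letter (0-based)
_‼_ : {S : Set} → List S → ℕ → Maybe S
[] ‼ i = nothing
(x ∷ u) ‼ zero = just x
(x ∷ u) ‼ suc i = u ‼ i

Period : {S : Set} → List S → ℕ → Set
Period u p = 1 ≤ p × (∀ i → i + p < length u → u ‼ i ≡ u ‼ (i + p))

SmallestPeriod : {S : Set} → List S → ℕ → Set
SmallestPeriod u p = Period u p × (∀ q → Period u q → p ≤ q)

-- exponent of a non-empty u (= |u|/p, p smallest period) is at least a/b
ExpAtLeast : {S : Set} → List S → ℕ → ℕ → Set
ExpAtLeast u a b = u ≢ [] × ∃[ p ] (SmallestPeriod u p × a * p ≤ length u * b)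

Free : {S : Set} → ℕ → ℕ → List S → Set
Free a b w = ∀ u → Factor u w → ¬ ExpAtLeast u a b

module Submission where

-- Fix a non-erasing morphism h and weigh each variable X by |h(X)|.  The heart of the
-- proof is a purely combinatorial fact about weighted nice formulas (`repetition`):
-- some fragment contains a factor X w X whose prefix X w weighs at most 2^(n-1) times X.  Let X be a lightest variable.  If X is the only
-- variable, niceness puts XX in a fragment.  Otherwise erase X from every fragment:
-- the result is a nice formula with n - 1 variables, so by induction it contains a short
-- Y v' Y, which lifts to a factor Y v Y of the original fragment (`factor-lift`).
-- Either the occurrences of X in v are light and Y v Y is still short, or they are heavy
-- and two of them are separated by a gap lighter than X (`light-gap`), giving a short
-- X w X.  Finally, h(X w X) = h(Xw) h(X) has period |h(Xw)|, so its exponent is at least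
-- 1 + 2^(1-n) (`border-exponent`); if f occurred in w under h this factor of w would
-- contradict (1 + 2^(1-n))-freeness.

open import Defs
open import Data.Nat using (ℕ; zero; suc; _+_; _*_; _^_; _≤_; _<_; z≤n; s≤s; _≤?_; _<?_)
open import Data.Nat.Properties
  using (≤-refl; ≤-reflexive; ≤-trans; ≤-<-trans; <-≤-trans; ≤-pred; <⇒≤; ≮⇒≥; ≰⇒>;
         +-assoc; +-comm; +-identityʳ; +-monoˡ-≤; +-monoʳ-≤; +-cancelˡ-<; m≤m+n; m≤n+m;
         *-monoˡ-≤; *-monoʳ-≤; *-assoc;
         *-comm; *-distribˡ-+; *-distribʳ-+; m^n>0; anyUpTo?; allUpTo?; _≟_; module ≤-Reasoning)
open import Data.Nat.Induction using (<-rec)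
open import Data.Nat.ListAction using (sum)
open import Data.Nat.ListAction.Properties using (sum-++)
open import Data.Fin using (Fin)
import Data.Fin as Fin
open import Data.List using (List; []; _∷_; _++_; length; concat; map; filter; deduplicate)
open import Data.List.Properties
  using (++-assoc; ++-identityʳ; ++-conicalˡ; ++-conicalʳ; length-++; length-++-≤ˡ; map-++;
         concatMap-++; ∷-injective; filter-accept; filter-reject; filter-notAll)
open import Data.List.Extrema.Nat using (argmin; argmin-all; f[argmin]≤f[xs])
open import Data.List.Membership.Propositional using (_∈_)
open import Data.List.Membership.Propositional.Properties
  using (∈-++⁺ʳ; ∈-concat⁺′; ∈-concat⁻′; ∈-map⁺; ∈-map⁻; ∈-filter⁺; ∈-filter⁻; ∈-length;
         ∈-deduplicate⁺)
open import Data.List.Relation.Unary.Any as Any using (here; there)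
import Data.List.Relation.Unary.All as All
open import Data.Maybe.Properties using (≡-dec)
open import Data.Product using (∃-syntax; _×_; _,_; proj₂)
open import Function using (id)
open import Relation.Binary.Definitions using (DecidableEquality)
open import Relation.Binary.PropositionalEquality
  using (_≡_; _≢_; refl; sym; trans; cong; subst; subst₂; module ≡-Reasoning)
open import Relation.Nullary using (Dec; yes; no; ¬?)
open import Relation.Nullary.Decidable using (map′; _×-dec_; _→-dec_)
open import Relation.Nullary.Negation using (contradiction)

factor-trans : ∀ {S : Set} {x y z : List S} → Factor x y → Factor y z → Factor x z
factor-trans {x = x} (u , u′ , refl) (a , b , refl) =
  a ++ u , u′ ++ b , (begin
    a ++ (u ++ x ++ u′) ++ b  ≡⟨ cong (a ++_) (++-assoc u _ b) ⟩
    a ++ u ++ (x ++ u′) ++ b  ≡⟨ cong (λ t → a ++ u ++ t) (++-assoc x u′ b) ⟩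
    a ++ u ++ x ++ u′ ++ b    ≡⟨ ++-assoc a u _ ⟨
    (a ++ u) ++ x ++ u′ ++ b  ∎)
  where open ≡-Reasoning

factor-prepend : ∀ {S : Set} {x y : List S} → Factor x y → ∀ a → Factor x (a ++ y)
factor-prepend (u , u′ , refl) a = a ++ u , u′ , sym (++-assoc a u _)

factor-head : ∀ {S : Set} {y : S} {s w} → Factor (y ∷ s) w → y ∈ w
factor-head (u , u′ , refl) = ∈-++⁺ʳ u (here refl)

factor-apply : ∀ {k} (h : Morphism k) {x y} → Factor x y → Factor (apply h x) (apply h y)
factor-apply h {x} (u , u′ , refl) =
  apply h u , apply h u′ ,
  trans (concatMap-++ h u (x ++ u′)) (cong (apply h u ++_) (concatMap-++ h x u′))

module FilterLift {A : Set} {P : A → Set} (P? : (x : A) → Dec (P x)) where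

  prefix-lift : ∀ ψ m z s → filter P? ψ ≡ m ++ z ∷ s →
                ∃[ m₀ ] ∃[ t ] (ψ ≡ m₀ ++ z ∷ t × filter P? m₀ ≡ m)
  prefix-lift [] [] z s ()
  prefix-lift [] (_ ∷ _) z s ()
  prefix-lift (x ∷ ψ) m z s e with P? x
  ... | no ¬px with prefix-lift ψ m z s e
  ...   | m₀ , t , refl , kept = x ∷ m₀ , t , refl , trans (filter-reject P? ¬px) kept
  prefix-lift (x ∷ ψ) [] z s refl | yes _ = [] , ψ , refl , refl
  prefix-lift (x ∷ ψ) (y ∷ m) z s e | yes px with ∷-injective e
  ... | refl , e′ with prefix-lift ψ m z s e′
  ...   | m₀ , t , refl , kept = x ∷ m₀ , t , refl , trans (filter-accept P? px) (cong (x ∷_) kept)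

  factor-lift : ∀ φ y m z → Factor (y ∷ m ++ z ∷ []) (filter P? φ) →
                ∃[ m₀ ] (Factor (y ∷ m₀ ++ z ∷ []) φ × filter P? m₀ ≡ m)
  factor-lift [] y m z ([] , _ , ())
  factor-lift [] y m z (_ ∷ _ , _ , ())
  factor-lift (x ∷ φ) y m z (u , u′ , e) with P? x
  ... | no _ with factor-lift φ y m z (u , u′ , e)
  ...   | m₀ , ym₀z⊑φ , kept = m₀ , factor-prepend ym₀z⊑φ (x ∷ []) , kept
  factor-lift (x ∷ φ) y m z (t ∷ u , u′ , e) | yes _
    with factor-lift φ y m z (u , u′ , proj₂ (∷-injective e))
  ... | m₀ , ym₀z⊑φ , kept = m₀ , factor-prepend ym₀z⊑φ (x ∷ []) , kept
  factor-lift (x ∷ φ) y m z ([] , u′ , e) | yes _ with ∷-injective e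
  ... | refl , e′ with prefix-lift φ m z u′ (trans e′ (++-assoc m (z ∷ []) u′))
  ...   | m₀ , t , refl , kept =
    m₀ , ([] , t , cong (x ∷_) (sym (++-assoc m₀ (z ∷ []) t))) , kept

other? : (X : Var) → (Y : Var) → Dec (X ≢ Y)
other? X Y = ¬? (X ≟ Y)

-- erase X φ deletes every occurrence of X from φ.  It splits on X ≟ Y exactly like occ,
-- so that a single case analysis computes both.
erase : Var → List Var → List Var
erase X [] = []
erase X (Y ∷ φ) with X ≟ Y
... | yes _ = erase X φ
... | no _  = Y ∷ erase X φ

-- Erasure is filtering by other? X, which makes the library's filter lemmas available.
erase-filter : ∀ X φ → erase X φ ≡ filter (other? X) φ
erase-filter X [] = refl
erase-filter X (Y ∷ φ) with X ≟ Y
... | yes X≡Y = trans (erase-filter X φ) (sym (filter-reject (other? X) (λ X≢Y → X≢Y X≡Y)))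
... | no X≢Y  = trans (cong (Y ∷_) (erase-filter X φ)) (sym (filter-accept (other? X) X≢Y))

occ-erase : ∀ {X Y} → X ≢ Y → ∀ φ → occ Y (erase X φ) ≡ occ Y φ
occ-erase X≢Y [] = refl
occ-erase {X} {Y} X≢Y (Z ∷ φ) with X ≟ Z
... | yes refl = trans (occ-erase X≢Y φ) (sym (occ-skip φ (λ Y≡X → X≢Y (sym Y≡X))))
  where
  occ-skip : ∀ ψ → Y ≢ X → occ Y (X ∷ ψ) ≡ occ Y ψ
  occ-skip ψ Y≢X with Y ≟ X
  ... | yes Y≡X = contradiction Y≡X Y≢X
  ... | no _    = refl
... | no _ with Y ≟ Z
...   | yes _ = cong suc (occ-erase X≢Y φ)
...   | no _  = occ-erase X≢Y φ

erase-shrinks : ∀ {X V} → X ∈ V → length (erase X V) < length V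
erase-shrinks {X} {V} X∈V = subst (λ l → length l < length V) (sym (erase-filter X V))
  (filter-notAll (other? X) V (Any.map (λ X≡Y X≢Y → X≢Y X≡Y) X∈V))

∈-erased⁻ : ∀ {X Y} F → Y ∈ concat (map (erase X) F) → Y ∈ concat F × X ≢ Y
∈-erased⁻ {X} F Y∈ with ∈-concat⁻′ (map (erase X) F) Y∈
... | ψ , Y∈ψ , ψ∈ with ∈-map⁻ (erase X) ψ∈
... | φ , φ∈ , refl with ∈-filter⁻ (other? X) (subst (_ ∈_) (erase-filter X φ) Y∈ψ)
... | Y∈φ , X≢Y = ∈-concat⁺′ Y∈φ φ∈ , X≢Y

nice-erase : ∀ X F → Nice F → Nice (map (erase X) F)
nice-erase X F nice Y Y∈ with ∈-erased⁻ F Y∈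
... | Y∈F , X≢Y with nice Y Y∈F
... | φ , φ∈ , twice = erase X φ , ∈-map⁺ (erase X) φ∈ , subst (2 ≤_) (sym (occ-erase X≢Y φ)) twice

square-factor : ∀ X φ → erase X φ ≡ [] → 2 ≤ occ X φ → Factor (X ∷ X ∷ []) φ
square-factor X (Z ∷ []) none twice with X ≟ Z
... | yes _ = contradiction twice λ { (s≤s ()) }
... | no _  = contradiction none λ ()
square-factor X (Z ∷ Z′ ∷ φ) none twice with X ≟ Z
... | no _ = contradiction none λ ()
... | yes refl with X ≟ Z′
...   | yes refl = [] , φ , refl
...   | no _     = contradiction none λ ()

erase-factor-lift : ∀ X φ Y v′ → Factor (Y ∷ v′ ++ Y ∷ []) (erase X φ) →
                    ∃[ v ] (Factor (Y ∷ v ++ Y ∷ []) φ × erase X v ≡ v′)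
erase-factor-lift X φ Y v′ YvY⊑ with FilterLift.factor-lift (other? X) φ Y v′ Y
                                       (subst (Factor _) (erase-filter X φ) YvY⊑)
... | v , YvY⊑φ , kept = v , YvY⊑φ , trans (erase-filter X v) kept

concat-empty : ∀ {S : Set} {xss : List (List S)} {xs} → concat xss ≡ [] → xs ∈ xss → xs ≡ []
concat-empty {xss = ys ∷ _} e (here refl) = ++-conicalˡ ys _ e
concat-empty {xss = ys ∷ _} e (there m)   = concat-empty (++-conicalʳ ys _ e) m

-- The three level bounds below use that 2 ^ suc n unfolds to 2 * 2 ^ n.
-- Repetitions with an empty gap have every level n + 1.
double-bound : ∀ n a → 2 * (a + 0) ≤ 2 ^ suc n * a
double-bound n a =
  ≤-trans (*-monoʳ-≤ 2 (*-monoˡ-≤ a (m^n>0 2 n))) (≤-reflexive (sym (*-assoc 2 (2 ^ n) a)))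

-- Adding at most a + b to a word of weight a + b at most doubles its weight.
few-extra-bound : ∀ a b c m → c ≤ a + b → 2 * (a + b) ≤ m * a → 2 * (a + (b + c)) ≤ (2 * m) * a
few-extra-bound a b c m few short = begin
  2 * (a + (b + c))        ≡⟨ cong (2 *_) (+-assoc a b c) ⟨
  2 * ((a + b) + c)        ≤⟨ *-monoʳ-≤ 2 (+-monoʳ-≤ (a + b) few) ⟩
  2 * ((a + b) + (a + b))  ≡⟨ cong (λ t → 2 * ((a + b) + t)) (+-identityʳ (a + b)) ⟨
  2 * (2 * (a + b))        ≤⟨ *-monoʳ-≤ 2 short ⟩
  2 * (m * a)              ≡⟨ *-assoc 2 m a ⟨
  (2 * m) * a              ∎
  where open ≤-Reasoning

-- A gap lighter than a gives a repetition of every level at least 2.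
light-gap-bound : ∀ n a b → 1 ≤ n → b < a → 2 * (a + b) ≤ 2 ^ suc n * a
light-gap-bound (suc n) a b _ b<a = begin
  2 * (a + b)          ≤⟨ *-monoʳ-≤ 2 (+-monoʳ-≤ a (<⇒≤ b<a)) ⟩
  2 * (a + a)          ≡⟨ cong (λ t → 2 * (a + t)) (+-identityʳ a) ⟨
  2 * (2 * a)          ≤⟨ *-monoʳ-≤ 2 (*-monoˡ-≤ a (*-monoʳ-≤ 2 (m^n>0 2 n))) ⟩
  2 * ((2 * 2 ^ n) * a) ≡⟨ *-assoc 2 (2 * 2 ^ n) a ⟨
  2 ^ suc (suc n) * a  ∎
  where open ≤-Reasoning

module Repetitions (wt : Var → ℕ) where

  weight : List Var → ℕ
  weight φ = sum (map wt φ)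

  weight-++ : ∀ a b → weight (a ++ b) ≡ weight a + weight b
  weight-++ a b = trans (cong sum (map-++ wt a b)) (sum-++ (map wt a) (map wt b))

  weight-erase : ∀ X φ → weight φ ≡ weight (erase X φ) + occ X φ * wt X
  weight-erase X [] = refl
  weight-erase X (Y ∷ φ) with X ≟ Y
  ... | yes refl = begin
    wt X + weight φ                                ≡⟨ cong (wt X +_) (weight-erase X φ) ⟩
    wt X + (weight (erase X φ) + occ X φ * wt X)   ≡⟨ +-assoc (wt X) _ _ ⟨
    (wt X + weight (erase X φ)) + occ X φ * wt X   ≡⟨ cong (_+ occ X φ * wt X) (+-comm (wt X) _) ⟩
    (weight (erase X φ) + wt X) + occ X φ * wt X   ≡⟨ +-assoc (weight (erase X φ)) _ _ ⟩
    weight (erase X φ) + (wt X + occ X φ * wt X)   ∎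
    where open ≡-Reasoning
  ... | no _ = trans (cong (wt Y +_) (weight-erase X φ)) (sym (+-assoc (wt Y) _ _))

  -- Pigeonhole for gaps.  Reading X w₀ r, where w₀ is the gap since the last X: if the
  -- X's of r outweigh w₀ and the other letters of r, some gap between two X's is lighter than X.
  light-gap-after : ∀ X w₀ r → weight w₀ + weight (erase X r) < occ X r * wt X →
                    ∃[ w ] (Factor (X ∷ w ++ X ∷ []) (X ∷ w₀ ++ r) × weight w < wt X)
  light-gap-after X w₀ [] ()
  light-gap-after X w₀ (Y ∷ r) heavier with X ≟ Y
  ... | yes refl with weight w₀ <? wt X
  ...   | yes light = w₀ , ([] , r , cong (X ∷_) (sym (++-assoc w₀ (X ∷ []) r))) , light
  ...   | no heavy
          with light-gap-after X [] r
                 (+-cancelˡ-< (wt X) _ _ (≤-<-trans (+-monoˡ-≤ _ (≮⇒≥ heavy)) heavier))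
  ...     | w , XwX⊑ , light = w , factor-prepend XwX⊑ (X ∷ w₀) , light
  light-gap-after X w₀ (Y ∷ r) heavier | no _
    with light-gap-after X (w₀ ++ Y ∷ []) r (subst (_< occ X r * wt X) regroup heavier)
    where
    regroup : weight w₀ + (wt Y + weight (erase X r)) ≡ weight (w₀ ++ Y ∷ []) + weight (erase X r)
    regroup = begin
      weight w₀ + (wt Y + weight (erase X r))  ≡⟨ +-assoc (weight w₀) _ _ ⟨
      (weight w₀ + wt Y) + weight (erase X r)
        ≡⟨ cong (λ t → (weight w₀ + t) + weight (erase X r)) (+-identityʳ (wt Y)) ⟨
      (weight w₀ + weight (Y ∷ [])) + weight (erase X r)
        ≡⟨ cong (_+ weight (erase X r)) (weight-++ w₀ (Y ∷ [])) ⟨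
      weight (w₀ ++ Y ∷ []) + weight (erase X r)  ∎
      where open ≡-Reasoning
  ... | w , XwX⊑ , light = w , subst (Factor _) (cong (X ∷_) (++-assoc w₀ (Y ∷ []) r)) XwX⊑ , light

  light-gap : ∀ X r → wt X + weight (erase X r) < occ X r * wt X →
              ∃[ w ] (Factor (X ∷ w ++ X ∷ []) r × weight w < wt X)
  light-gap X [] ()
  light-gap X (Y ∷ r) heavier with X ≟ Y
  ... | yes refl = light-gap-after X [] r (+-cancelˡ-< (wt X) _ _ heavier)
  ... | no _ with light-gap X r (≤-<-trans (+-monoʳ-≤ (wt X) (m≤n+m _ (wt Y))) heavier)
  ...   | w , XwX⊑ , light = w , factor-prepend XwX⊑ (Y ∷ []) , light

  -- A repetition of level n in F: a factor X w X of a fragment with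
  -- weight (X w) ≤ 2^(n-1) wt X.
  Repetition : Formula → ℕ → Set
  Repetition F n = ∃[ X ] ∃[ w ] ∃[ φ ]
    (φ ∈ F × Factor (X ∷ w ++ X ∷ []) φ × 2 * weight (X ∷ w) ≤ 2 ^ n * wt X)

  lightest : ∀ {Z xs} → Z ∈ xs → ∃[ X ] (X ∈ xs × (∀ {Y} → Y ∈ xs → wt X ≤ wt Y))
  lightest {Z} {xs} Z∈ =
    argmin wt Z xs , argmin-all wt Z∈ (All.tabulate id) , All.lookup (f[argmin]≤f[xs] {f = wt} Z xs)

  repetition-lone : ∀ {X F} n → X ∈ concat F → Nice F → concat (map (erase X) F) ≡ [] →
                    Repetition F (suc n)
  repetition-lone {X} n X∈ nice nothing-left with nice X X∈
  ... | φ , φ∈ , twice =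
    X , [] , φ , φ∈ , square-factor X φ (concat-empty nothing-left (∈-map⁺ (erase X) φ∈)) twice ,
    double-bound n (wt X)

  -- Its factor
  -- Y v′ Y lifts to Y v Y; either the X's in v are light and Y v Y is short, or they are
  -- heavy and enclose a gap lighter than X.
  repetition-lift : ∀ {X F n} → 1 ≤ n → (∀ {Y} → Y ∈ concat F → wt X ≤ wt Y) →
                    Repetition (map (erase X) F) n → Repetition F (suc n)
  repetition-lift {X} {n = n} 1≤n X-lightest (Y , _ , ψ , ψ∈ , YvY⊑ψ , short)
    with ∈-map⁻ (erase X) ψ∈
  ... | φ , φ∈ , refl with erase-factor-lift X φ Y _ YvY⊑ψ
  ... | v , YvY⊑φ , refl with occ X v * wt X ≤? wt Y + weight (erase X v)
  ...   | yes light-X's = Y , v , φ , φ∈ , YvY⊑φ , bound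
    where
    bound : 2 * (wt Y + weight v) ≤ 2 ^ suc n * wt Y
    bound = subst (λ t → 2 * (wt Y + t) ≤ 2 ^ suc n * wt Y) (sym (weight-erase X v))
              (few-extra-bound (wt Y) (weight (erase X v)) _ (2 ^ n) light-X's short)
  ...   | no heavy-X's with light-gap X v heavier
    where
    heavier : wt X + weight (erase X v) < occ X v * wt X
    heavier = ≤-<-trans (+-monoˡ-≤ _ (X-lightest (∈-concat⁺′ (factor-head YvY⊑φ) φ∈)))
                        (≰⇒> heavy-X's)
  ...     | w , XwX⊑v , light =
    X , w , φ , φ∈ , factor-trans XwX⊑v (factor-trans (Y ∷ [] , Y ∷ [] , refl) YvY⊑φ) ,
    light-gap-bound n (wt X) (weight w) 1≤n light

  repetition : ∀ n F V → (∀ {Y} → Y ∈ concat F → Y ∈ V) → length V ≤ n → Nice F →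
               ∀ {Z} → Z ∈ concat F → Repetition F n
  repetition zero _ [] covered _ _ Z∈ with () ← covered Z∈
  repetition (suc n) F V covered |V|≤ nice Z∈ with lightest Z∈
  ... | X , X∈ , X-lightest with concat (map (erase X) F) in remaining
  ...   | [] = repetition-lone n X∈ nice remaining
  ...   | Y ∷ _ = repetition-lift (≤-trans (∈-length (covered′ Y∈)) |V′|≤n) X-lightest
                    (repetition n (map (erase X) F) (erase X V) covered′ |V′|≤n
                                (nice-erase X F nice) Y∈)
    where
    Y∈ : Y ∈ concat (map (erase X) F)
    Y∈ = subst (Y ∈_) (sym remaining) (here refl)
    covered′ : ∀ {Y} → Y ∈ concat (map (erase X) F) → Y ∈ erase X V
    covered′ Y∈F′ with ∈-erased⁻ F Y∈F′
    ... | Y∈F , X≢Y = subst (_ ∈_) (sym (erase-filter X V)) (∈-filter⁺ (other? X) (covered Y∈F) X≢Y)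
    |V′|≤n : length (erase X V) ≤ n
    |V′|≤n = ≤-pred (≤-trans (erase-shrinks (covered X∈)) |V|≤)

‼-++ˡ : ∀ {S : Set} (a c : List S) i → i < length a → (a ++ c) ‼ i ≡ a ‼ i
‼-++ˡ (x ∷ a) c zero    _         = refl
‼-++ˡ (x ∷ a) c (suc i) (s≤s i<a) = ‼-++ˡ a c i i<a

‼-++ʳ : ∀ {S : Set} (a c : List S) j → (a ++ c) ‼ (length a + j) ≡ c ‼ j
‼-++ʳ []      c j = refl
‼-++ʳ (x ∷ a) c j = ‼-++ʳ a c j

prefix-period : ∀ {S : Set} (x y z : List S) → x ≢ [] → x ≡ y ++ z → Period (x ++ y) (length x)
prefix-period [] y z x≢[] _ = contradiction refl x≢[]
prefix-period x@(_ ∷ _) y z _ x≡yz = s≤s z≤n , matches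
  where
  matches : ∀ i → i + length x < length (x ++ y) → (x ++ y) ‼ i ≡ (x ++ y) ‼ (i + length x)
  matches i inside = begin
    (x ++ y) ‼ i                ≡⟨ ‼-++ˡ x y i (<-≤-trans i<|y| |y|≤|x|) ⟩
    x ‼ i                       ≡⟨ cong (_‼ i) x≡yz ⟩
    (y ++ z) ‼ i                ≡⟨ ‼-++ˡ y z i i<|y| ⟩
    y ‼ i                       ≡⟨ ‼-++ʳ x y i ⟨
    (x ++ y) ‼ (length x + i)   ≡⟨ cong ((x ++ y) ‼_) (+-comm (length x) i) ⟩
    (x ++ y) ‼ (i + length x)   ∎
    where
    open ≡-Reasoning
    |y|≤|x| : length y ≤ length x
    |y|≤|x| = subst (λ t → length y ≤ length t) (sym x≡yz) (length-++-≤ˡ y)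
    i<|y| : i < length y
    i<|y| = +-cancelˡ-< (length x) i (length y)
              (subst₂ _<_ (+-comm i (length x)) (length-++ x) inside)

module Exponents {S : Set} (_≟ₛ_ : DecidableEquality S) where

  period? : (u : List S) (p : ℕ) → Dec (Period u p)
  period? u p = (1 ≤? p) ×-dec map′ unbounded bounded (allUpTo? matches? (length u))
    where
    Matches : ℕ → Set
    Matches i = i + p < length u → u ‼ i ≡ u ‼ (i + p)
    matches? : (i : ℕ) → Dec (Matches i)
    matches? i = (i + p <? length u) →-dec ≡-dec _≟ₛ_ (u ‼ i) (u ‼ (i + p))
    unbounded : (∀ {i} → i < length u → Matches i) → ∀ i → Matches i
    unbounded all i inside = all (≤-<-trans (m≤m+n i p) inside) inside
    bounded : (∀ i → Matches i) → ∀ {i} → i < length u → Matches i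
    bounded all {i} _ = all i

  smallest-period : ∀ {u} p → Period u p → ∃[ q ] SmallestPeriod u q
  smallest-period {u} = <-rec (λ p → Period u p → ∃[ q ] SmallestPeriod u q) search
    where
    search : ∀ p → (∀ {q} → q < p → Period u q → ∃[ r ] SmallestPeriod u r) →
             Period u p → ∃[ q ] SmallestPeriod u q
    search p smaller period-p with anyUpTo? (period? u) p
    ... | yes (q , q<p , period-q) = smaller q<p period-q
    ... | no none = p , period-p , λ q period-q → ≮⇒≥ (λ q<p → none (q , q<p , period-q))

  exponent-from-period : ∀ {u p a b} → u ≢ [] → Period u p → a * p ≤ length u * b → ExpAtLeast u a b
  exponent-from-period {u} {p} {a} u≢[] period-p short with smallest-period {u} p period-p
  ... | q , least@(_ , minimal) =
    u≢[] , q , least , ≤-trans (*-monoʳ-≤ a (minimal p period-p)) short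

  -- If y is a non-empty prefix of x and 2|x| ≤ 2^n |y|, then x y has exponent at least
  -- (2^n + 2) / 2^n = 1 + 2^(1-n).
  border-exponent : ∀ (x y z : List S) n → y ≢ [] → x ≡ y ++ z → 2 * length x ≤ 2 ^ n * length y →
                    ExpAtLeast (x ++ y) (2 ^ n + 2) (2 ^ n)
  border-exponent x y z n y≢[] x≡yz short =
    exponent-from-period {x ++ y} {a = 2 ^ n + 2} {b = 2 ^ n}
      (λ xy≡[] → x≢[] (++-conicalˡ x y xy≡[]))
      (prefix-period x y z x≢[] x≡yz) bound
    where
    x≢[] : x ≢ []
    x≢[] x≡[] = y≢[] (++-conicalˡ y z (trans (sym x≡yz) x≡[]))
    open ≤-Reasoning
    bound : (2 ^ n + 2) * length x ≤ length (x ++ y) * 2 ^ n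
    bound = begin
      (2 ^ n + 2) * length x                ≡⟨ *-distribʳ-+ (length x) (2 ^ n) 2 ⟩
      2 ^ n * length x + 2 * length x       ≤⟨ +-monoʳ-≤ (2 ^ n * length x) short ⟩
      2 ^ n * length x + 2 ^ n * length y   ≡⟨ *-distribˡ-+ (2 ^ n) (length x) (length y) ⟨
      2 ^ n * (length x + length y)         ≡⟨ *-comm (2 ^ n) _ ⟩
      (length x + length y) * 2 ^ n         ≡⟨ cong (_* 2 ^ n) (length-++ x) ⟨
      length (x ++ y) * 2 ^ n               ∎

some-variable : ∀ f → Fragments-nonempty f → f ≢ [] → ∃[ Z ] Z ∈ concat f
some-variable []              _        f≢[] = contradiction refl f≢[]
some-variable ([] ∷ _)        nonempty _    = contradiction refl (nonempty [] (here refl))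
some-variable ((Z ∷ _) ∷ _)   _        _    = Z , here refl

weight-apply : ∀ {k} (h : Morphism k) u →
               Repetitions.weight (λ Y → length (h Y)) u ≡ length (apply h u)
weight-apply h []      = refl
weight-apply h (Y ∷ u) = trans (cong (length (h Y) +_) (weight-apply h u)) (sym (length-++ (h Y)))

apply-return : ∀ {k} (h : Morphism k) X u → apply h (X ∷ u ++ X ∷ []) ≡ apply h (X ∷ u) ++ h X
apply-return h X u =
  trans (concatMap-++ h (X ∷ u) (X ∷ [])) (cong (apply h (X ∷ u) ++_) (++-identityʳ (h X)))

lemma3 : (f : Formula) → Fragments-nonempty f → f ≢ [] → Nice f →
         (k : ℕ) (w : List (Fin k)) →
         Free (2 ^ v f + 2) (2 ^ v f) w → Avoids f w
lemma3 f nonempty f≢[] nice _ _ free h (non-erasing , occurs)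
  with some-variable f nonempty f≢[]
... | _ , Z∈
  with repetition (v f) f (deduplicate _≟_ (concat f)) (∈-deduplicate⁺ _≟_) ≤-refl nice Z∈
  where open Repetitions (λ Y → length (h Y))
... | X , u , φ , φ∈ , XuX⊑φ , short =
  free (apply h (X ∷ u ++ X ∷ [])) (factor-trans (factor-apply h XuX⊑φ) (occurs φ φ∈))
    (subst (λ t → ExpAtLeast t (2 ^ v f + 2) (2 ^ v f)) (sym (apply-return h X u))
      (border-exponent (apply h (X ∷ u)) (h X) (apply h u) (v f) (non-erasing X) refl
        (subst (λ t → 2 * t ≤ 2 ^ v f * length (h X)) (weight-apply h (X ∷ u)) short)))
  where open Exponents Fin._≟_
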